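{- Let $W$ be a non-empty set and let $\mathfrak{A}$ be a family of binary relations on $W$ closed under $\backslash$, $/$ and $\cap$ (not necessarily under $\circ$). Suppose $\mathbf{0}_{\mathfrak{A}}\in\mathfrak{A}$ satisfies $\mathbf{0}_{\mathfrak{A}}\subseteq R$ for every $R\in\mathfrak{A}$. Then $\mathbf{0}_{\mathfrak{A}}\circ R\subseteq\mathbf{0}_{\mathfrak{A}}$ and $R\circ\mathbf{0}_{\mathfrak{A}}\subseteq\mathbf{0}_{\mathfrak{A}}$ for every $R\in\mathfrak{A}$.
   Context: For binary relations $R,S$ on $W$: $R\circ S=\{(x,z) \mid \exists y\in W\,((x,y)\in R \text{ and } (y,z)\in S)\}$; $R\backslash S=\{(y,z)\in W\times W \mid \forall x\in W\,((x,y)\in R\Rightarrow (x,z)\in S)\}$; $S/R=\{(x,y)\in W\times W \mid \forall z\in W\,((y,z)\in R\Rightarrow(x,z)\in S)\}$. -}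

module Defs where

open import Level using (suc; zero)
open import Data.Product using (Σ; _×_; ∃-syntax)

BinRel : Set → Set₁
BinRel W = W → W → Set

module _ {W : Set} where

  _∘ᵣ_ : BinRel W → BinRel W → BinRel W
  (R ∘ᵣ S) x z = ∃[ y ] (R x y × S y z)

  _＼_ : BinRel W → BinRel W → BinRel W
  (R ＼ S) y z = ∀ x → R x y → S x z

  _／_ : BinRel W → BinRel W → BinRel W
  (S ／ R) x y = ∀ z → R y z → S x z

  _∩ᵣ_ : BinRel W → BinRel W → BinRel W
  (R ∩ᵣ S) x y = R x y × S x y

  _⊆ᵣ_ : BinRel W → BinRel W → Set
  R ⊆ᵣ S = ∀ x y → R x y → S x y

Family : Set → Set₁
Family W = BinRel W → Set

{-# OPTIONS --safe #-}
module Submission where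

open import Defs
open import Data.Product using (_×_; _,_)

-- By residuation, 𝟘 ∘ R ⊆ 𝟘 follows from 𝟘 ⊆ 𝟘 ／ R and R ∘ 𝟘 ⊆ 𝟘 from
-- 𝟘 ⊆ R ＼ 𝟘; both residuals lie in the family, so the least element is
-- below them.

module _ {W : Set} where

  ⊆-／⇒∘-⊆ : (P R S : BinRel W) → P ⊆ᵣ (S ／ R) → (P ∘ᵣ R) ⊆ᵣ S
  ⊆-／⇒∘-⊆ P R S P⊆S／R x z (y , Pxy , Ryz) = P⊆S／R x y Pxy z Ryz

  ⊆-＼⇒∘-⊆ : (P R S : BinRel W) → P ⊆ᵣ (R ＼ S) → (R ∘ᵣ P) ⊆ᵣ S
  ⊆-＼⇒∘-⊆ P R S P⊆R＼S x z (y , Rxy , Pyz) = P⊆R＼S y z Pyz x Rxy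

lemma7p1 : (W : Set) → W → (𝔄 : Family W)
    → (∀ R S → 𝔄 R → 𝔄 S → 𝔄 (R ＼ S))
    → (∀ R S → 𝔄 R → 𝔄 S → 𝔄 (S ／ R))
    → (∀ R S → 𝔄 R → 𝔄 S → 𝔄 (R ∩ᵣ S))
    → (𝟘 : BinRel W) → 𝔄 𝟘 → (∀ R → 𝔄 R → 𝟘 ⊆ᵣ R)
    → ∀ R → 𝔄 R → ((𝟘 ∘ᵣ R) ⊆ᵣ 𝟘) × ((R ∘ᵣ 𝟘) ⊆ᵣ 𝟘)
lemma7p1 W _ 𝔄 ＼-closed ／-closed _ 𝟘 𝔄𝟘 𝟘-least R 𝔄R =
    ⊆-／⇒∘-⊆ 𝟘 R 𝟘 (𝟘-least (𝟘 ／ R) (／-closed R 𝟘 𝔄R 𝔄𝟘))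
  , ⊆-＼⇒∘-⊆ 𝟘 R 𝟘 (𝟘-least (R ＼ 𝟘) (＼-closed R 𝟘 𝔄R 𝔄𝟘))
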